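{- For every instance of Unlabeled Pebble Motion on Trees with $n$ nodes and $k$ pebbles, $\mathit{OPT}\le k(n-1)$.
   Context: Unlabeled Pebble Motion on Trees: a tree $T=(V,E)$ with $n=|V|$ nodes; $k$ pebbles initially occupy $k$ distinct nodes; $k$ distinct nodes are targets (may coincide with starting nodes). A move moves one pebble from its current node to an adjacent pebble-free node; a plan is a sequence of moves, feasible if afterwards every pebble is on a target; its length is the number of moves. $\mathit{OPT}$ denotes the minimum length of a feasible plan. -}

module Defs where

open import Data.Nat using (ℕ; zero; suc; _≤_)
open import Data.Fin using (Fin)
open import Data.Fin.Subset using (Subset; _∈_; _∉_; inside; outside)
open import Data.Vec using (_[_]≔_)
open import Data.List using (List; []; _∷_; length)
open import Data.List.Relation.Unary.Unique.Propositional using (Unique)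
open import Data.Product using (_×_; _,_; ∃; Σ)
open import Data.Sum using (_⊎_)
open import Relation.Binary.PropositionalEquality using (_≡_)
open import Relation.Nullary using (¬_)
import Data.List.Membership.Propositional as L

record Graph (n : ℕ) : Set where
  field
    edges : List (Fin n × Fin n)

open Graph public

Adj : ∀ {n} → Graph n → Fin n → Fin n → Set
Adj G u v = (u , v) L.∈ edges G ⊎ (v , u) L.∈ edges G

data Walk {n} (G : Graph n) : Fin n → Fin n → Set where
  here : ∀ {u} → Walk G u u
  step : ∀ {u w v} → Adj G u w → Walk G w v → Walk G u v

Connected : ∀ {n} → Graph n → Set
Connected G = ∀ u v → Walk G u v

Path : ∀ {n} → Graph n → List (Fin n) → Set
Path G [] = Data.Unit.⊤ where import Data.Unit
Path G (x ∷ []) = Data.Unit.⊤ where import Data.Unit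
Path G (x ∷ y ∷ xs) = Adj G x y × Path G (y ∷ xs)

lastOr : ∀ {A : Set} → A → List A → A
lastOr d [] = d
lastOr d (x ∷ xs) = lastOr x xs

Cycle : ∀ {n} → Graph n → List (Fin n) → Set
Cycle G [] = Data.Empty.⊥ where import Data.Empty
Cycle G (x ∷ xs) = 3 ≤ length (x ∷ xs) × Unique (x ∷ xs) × Path G (x ∷ xs) × Adj G (lastOr x xs) x

Loopless : ∀ {n} → Graph n → Set
Loopless G = ∀ u → ¬ Adj G u u

Acyclic : ∀ {n} → Graph n → Set
Acyclic G = ∀ cs → ¬ Cycle G cs

IsTree : ∀ {n} → Graph n → Set
IsTree {n} G = 1 ≤ n × Loopless G × Connected G × Acyclic G

-- Unlabeled configurations: the set of pebble-occupied nodes.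
-- One move: a pebble on u moves to an adjacent pebble-free node v.
Move : ∀ {n} → Graph n → Subset n → Subset n → Set
Move G C C' = ∃ λ u → ∃ λ v → Adj G u v × u ∈ C × v ∉ C
                × C' ≡ ((C [ u ]≔ outside) [ v ]≔ inside)

data Plan {n} (G : Graph n) : Subset n → Subset n → ℕ → Set where
  done : ∀ {C} → Plan G C C zero
  move : ∀ {C C' D m} → Move G C C' → Plan G C' D m → Plan G C D (suc m)

-- Call a pebble misplaced when its node is not a target. With as many pebbles as targets,
-- misplaced pebbles and vacant targets are equally many, at most k. Join a misplaced pebble u
-- to a vacant target v by a simple path (at most n ∸ 1 edges) and shift pebbles along it: one
-- move per edge, with the net effect of emptying u and filling v. This round leaves one fewer
-- misplaced pebble, so at most k rounds are needed.
module Submission where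

open import Defs
open import Data.Nat using (ℕ; _≤_; _*_; _∸_)
open import Data.Fin.Subset using (Subset; ∣_∣)
open import Data.Product using (∃; _×_)
open import Relation.Binary.PropositionalEquality using (_≡_)

open import Function using (_∘_)
open import Data.Nat using (zero; suc; _+_; z≤n; s≤s)
open import Data.Nat.Properties using (≤-trans; +-mono-≤; *-monoˡ-≤; +-cancelʳ-≡; +-suc; ∸-monoˡ-≤; suc-injective)
open import Data.Bool.Properties using (¬-not)
open import Data.Fin using (Fin; _≟_)
open import Data.Fin.Properties using (injective⇒≤)
open import Data.Fin.Subset using (_∈_; _∉_; _⊆_; _─_; _∩_; inside; outside; Nonempty)
open import Data.Fin.Subset.Properties
  using (_∈?_; nonempty?; Empty-unique; ∣⊥∣≡0; ∩-comm; ⊆-antisym; x∈p∧x∉q⇒x∈p─q; p─q⊆p; ∣p─q∣≤∣p∣)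
open import Data.Vec using ([]; _∷_; lookup; _[_]≔_; here; there)
open import Data.Vec.Properties
  using ([]≔-idempotent; []≔-commutes; []≔-updates; []≔-lookup; lookup∘update; lookup∘update′; []=⇒lookup; lookup⇒[]=)
open import Data.List using (List; length)
import Data.List as List
import Data.List.Relation.Unary.All as All
open import Data.List.Relation.Unary.All.Properties using (¬Any⇒All¬)
open import Data.List.Relation.Unary.AllPairs using ([]; _∷_)
import Data.List.Relation.Unary.Any as Any
open import Data.List.Relation.Unary.Unique.Propositional using (Unique)
open import Data.List.Membership.Propositional using () renaming (_∈_ to _∈ₗ_)
open import Data.List.Membership.Propositional.Properties using (∈-lookup)
import Data.List.Membership.DecPropositional as DecMembership
open import Data.Product using (_,_)
open import Relation.Nullary using (yes; no; contradiction)
open import Relation.Nullary.Decidable using (decidable-stable)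
open import Relation.Binary.PropositionalEquality using (refl; sym; trans; cong; subst; _≢_; module ≡-Reasoning)
open ≡-Reasoning

private variable
  n : ℕ
  x : Fin n
  p q : Subset n

x∈p⇒∣p∣≡1+∣p[x]≔outside∣ : x ∈ p → ∣ p ∣ ≡ suc ∣ p [ x ]≔ outside ∣
x∈p⇒∣p∣≡1+∣p[x]≔outside∣ here = refl
x∈p⇒∣p∣≡1+∣p[x]≔outside∣ {p = inside ∷ p} (there x∈p) = cong suc (x∈p⇒∣p∣≡1+∣p[x]≔outside∣ x∈p)
x∈p⇒∣p∣≡1+∣p[x]≔outside∣ {p = outside ∷ p} (there x∈p) = x∈p⇒∣p∣≡1+∣p[x]≔outside∣ x∈p

∣p∣≡1+r⇒Nonempty : ∀ {r} → ∣ p ∣ ≡ suc r → Nonempty p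
∣p∣≡1+r⇒Nonempty {n} {p} ∣p∣≡1+r with nonempty? p
... | yes ne = ne
... | no ∅ = contradiction (trans (sym ∣p∣≡1+r) (trans (cong ∣_∣ (Empty-unique ∅)) (∣⊥∣≡0 n))) λ ()

∣p─q∣≡0⇒p⊆q : ∣ p ─ q ∣ ≡ 0 → p ⊆ q
∣p─q∣≡0⇒p⊆q {q = q} ∣p─q∣≡0 {x} x∈p = decidable-stable (x ∈? q) λ x∉q →
  contradiction (trans (sym ∣p─q∣≡0) (x∈p⇒∣p∣≡1+∣p[x]≔outside∣ (x∈p∧x∉q⇒x∈p─q x∈p x∉q))) λ ()

x∈p─q⇒x∉q : x ∈ p ─ q → x ∉ q
x∈p─q⇒x∉q {p = _ ∷ _} {q = outside ∷ _} (there x∈p─q) (there x∈q) = x∈p─q⇒x∉q x∈p─q x∈q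
x∈p─q⇒x∉q {p = _ ∷ _} {q = inside ∷ _} (there x∈p─q) (there x∈q) = x∈p─q⇒x∉q x∈p─q x∈q

∣p∣≡∣p─q∣+∣p∩q∣ : ∀ (p q : Subset n) → ∣ p ∣ ≡ ∣ p ─ q ∣ + ∣ p ∩ q ∣
∣p∣≡∣p─q∣+∣p∩q∣ [] [] = refl
∣p∣≡∣p─q∣+∣p∩q∣ (inside ∷ p) (inside ∷ q) = trans (cong suc (∣p∣≡∣p─q∣+∣p∩q∣ p q)) (sym (+-suc _ _))
∣p∣≡∣p─q∣+∣p∩q∣ (inside ∷ p) (outside ∷ q) = cong suc (∣p∣≡∣p─q∣+∣p∩q∣ p q)
∣p∣≡∣p─q∣+∣p∩q∣ (outside ∷ p) (inside ∷ q) = ∣p∣≡∣p─q∣+∣p∩q∣ p q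
∣p∣≡∣p─q∣+∣p∩q∣ (outside ∷ p) (outside ∷ q) = ∣p∣≡∣p─q∣+∣p∩q∣ p q

∣p∣≡∣q∣⇒∣p─q∣≡∣q─p∣ : ∀ (p q : Subset n) → ∣ p ∣ ≡ ∣ q ∣ → ∣ p ─ q ∣ ≡ ∣ q ─ p ∣
∣p∣≡∣q∣⇒∣p─q∣≡∣q─p∣ p q ∣p∣≡∣q∣ = +-cancelʳ-≡ ∣ p ∩ q ∣ _ _ (begin
  ∣ p ─ q ∣ + ∣ p ∩ q ∣ ≡⟨ sym (∣p∣≡∣p─q∣+∣p∩q∣ p q) ⟩
  ∣ p ∣                 ≡⟨ ∣p∣≡∣q∣ ⟩
  ∣ q ∣                 ≡⟨ ∣p∣≡∣p─q∣+∣p∩q∣ q p ⟩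
  ∣ q ─ p ∣ + ∣ q ∩ p ∣ ≡⟨ cong (λ r → ∣ q ─ p ∣ + ∣ r ∣) (∩-comm q p) ⟩
  ∣ q ─ p ∣ + ∣ p ∩ q ∣ ∎)

x∈q⇒p[x]≔b─q≡p─q : x ∈ q → ∀ (p : Subset n) b → (p [ x ]≔ b) ─ q ≡ p ─ q
x∈q⇒p[x]≔b─q≡p─q here (_ ∷ _) _ = refl
x∈q⇒p[x]≔b─q≡p─q {q = inside ∷ _} (there x∈q) (_ ∷ p) b = cong (outside ∷_) (x∈q⇒p[x]≔b─q≡p─q x∈q p b)
x∈q⇒p[x]≔b─q≡p─q {q = outside ∷ _} (there x∈q) (a ∷ p) b = cong (a ∷_) (x∈q⇒p[x]≔b─q≡p─q x∈q p b)

x∉q⇒p[x]≔b─q≡[p─q][x]≔b : x ∉ q → ∀ (p : Subset n) b → (p [ x ]≔ b) ─ q ≡ (p ─ q) [ x ]≔ b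
x∉q⇒p[x]≔b─q≡[p─q][x]≔b {x = Fin.zero} {q = inside ∷ _} x∉q _ _ = contradiction here x∉q
x∉q⇒p[x]≔b─q≡[p─q][x]≔b {x = Fin.zero} {q = outside ∷ _} _ (_ ∷ _) _ = refl
x∉q⇒p[x]≔b─q≡[p─q][x]≔b {x = Fin.suc x} {q = inside ∷ _} x∉q (_ ∷ p) b =
  cong (outside ∷_) (x∉q⇒p[x]≔b─q≡[p─q][x]≔b (x∉q ∘ there) p b)
x∉q⇒p[x]≔b─q≡[p─q][x]≔b {x = Fin.suc x} {q = outside ∷ _} x∉q (a ∷ p) b =
  cong (a ∷_) (x∉q⇒p[x]≔b─q≡[p─q][x]≔b (x∉q ∘ there) p b)

q─p[x]≔inside≡[q─p][x]≔outside : ∀ (q p : Subset n) x → q ─ (p [ x ]≔ inside) ≡ (q ─ p) [ x ]≔ outside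
q─p[x]≔inside≡[q─p][x]≔outside (_ ∷ _) (_ ∷ _) Fin.zero = refl
q─p[x]≔inside≡[q─p][x]≔outside (a ∷ q) (inside ∷ p) (Fin.suc x) =
  cong (outside ∷_) (q─p[x]≔inside≡[q─p][x]≔outside q p x)
q─p[x]≔inside≡[q─p][x]≔outside (a ∷ q) (outside ∷ p) (Fin.suc x) =
  cong (a ∷_) (q─p[x]≔inside≡[q─p][x]≔outside q p x)

x∉q⇒q─p[x]≔outside≡q─p : x ∉ q → ∀ (p : Subset n) → q ─ (p [ x ]≔ outside) ≡ q ─ p
x∉q⇒q─p[x]≔outside≡q─p {x = Fin.zero} {q = inside ∷ _} x∉q _ = contradiction here x∉q
x∉q⇒q─p[x]≔outside≡q─p {x = Fin.zero} {q = outside ∷ _} _ (inside ∷ _) = refl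
x∉q⇒q─p[x]≔outside≡q─p {x = Fin.zero} {q = outside ∷ _} _ (outside ∷ _) = refl
x∉q⇒q─p[x]≔outside≡q─p {x = Fin.suc x} {q = a ∷ _} x∉q (inside ∷ p) =
  cong (outside ∷_) (x∉q⇒q─p[x]≔outside≡q─p (x∉q ∘ there) p)
x∉q⇒q─p[x]≔outside≡q─p {x = Fin.suc x} {q = a ∷ _} x∉q (outside ∷ p) =
  cong (a ∷_) (x∉q⇒q─p[x]≔outside≡q─p (x∉q ∘ there) p)

x∈p⇒p[x]≔inside≡p : x ∈ p → p [ x ]≔ inside ≡ p
x∈p⇒p[x]≔inside≡p {x = x} {p = p} x∈p = trans (cong (p [ x ]≔_) (sym ([]=⇒lookup x∈p))) ([]≔-lookup p x)

x∉p⇒p[x]≔outside≡p : x ∉ p → p [ x ]≔ outside ≡ p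
x∉p⇒p[x]≔outside≡p {x = x} {p = p} x∉p =
  trans (cong (p [ x ]≔_) (sym (¬-not (x∉p ∘ lookup⇒[]= x p)))) ([]≔-lookup p x)

relocate : Subset n → Fin n → Fin n → Subset n
relocate C u v = (C [ u ]≔ outside) [ v ]≔ inside

module _ {C : Subset n} {u v : Fin n} where

  v∈relocate : v ∈ relocate C u v
  v∈relocate = []≔-updates (C [ u ]≔ outside) v

  u∉relocate : u ≢ v → u ∉ relocate C u v
  u∉relocate u≢v u∈ = contradiction
    (trans (sym ([]=⇒lookup u∈)) (trans (lookup∘update′ u≢v (C [ u ]≔ outside) inside) (lookup∘update u C outside)))
    λ ()

  lookup-relocate : x ≢ u → x ≢ v → lookup (relocate C u v) x ≡ lookup C x
  lookup-relocate x≢u x≢v = trans (lookup∘update′ x≢v (C [ u ]≔ outside) inside) (lookup∘update′ x≢u C outside)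

  ∈-relocate⁺ : x ≢ u → x ≢ v → x ∈ C → x ∈ relocate C u v
  ∈-relocate⁺ {x} x≢u x≢v x∈C = lookup⇒[]= x _ (trans (lookup-relocate x≢u x≢v) ([]=⇒lookup x∈C))

  ∈-relocate⁻ : x ≢ u → x ≢ v → x ∈ relocate C u v → x ∈ C
  ∈-relocate⁻ {x} x≢u x≢v x∈ = lookup⇒[]= x C (trans (sym (lookup-relocate x≢u x≢v)) ([]=⇒lookup x∈))

relocate-via-vacant : ∀ {C : Subset n} {u x} v → x ∉ C → u ≢ x →
  relocate (relocate C u x) x v ≡ relocate C u v
relocate-via-vacant {C = C} {u} {x} v x∉C u≢x = cong (_[ v ]≔ inside) (begin
  ((C [ u ]≔ outside) [ x ]≔ inside) [ x ]≔ outside ≡⟨ []≔-idempotent (C [ u ]≔ outside) x ⟩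
  (C [ u ]≔ outside) [ x ]≔ outside                 ≡⟨ []≔-commutes C u x u≢x ⟩
  (C [ x ]≔ outside) [ u ]≔ outside                 ≡⟨ cong (_[ u ]≔ outside) (x∉p⇒p[x]≔outside≡p x∉C) ⟩
  C [ u ]≔ outside                                  ∎)

relocate-via-occupied : ∀ {C : Subset n} {u x v} → x ∈ C → u ≢ x → u ≢ v → x ≢ v →
  relocate (relocate C x v) u x ≡ relocate C u v
relocate-via-occupied {C = C} {u} {x} {v} x∈C u≢x u≢v x≢v = begin
  (((C [ x ]≔ outside) [ v ]≔ inside) [ u ]≔ outside) [ x ]≔ inside
    ≡⟨ cong (_[ x ]≔ inside) ([]≔-commutes (C [ x ]≔ outside) v u (u≢v ∘ sym)) ⟩
  (((C [ x ]≔ outside) [ u ]≔ outside) [ v ]≔ inside) [ x ]≔ inside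
    ≡⟨ []≔-commutes ((C [ x ]≔ outside) [ u ]≔ outside) v x (x≢v ∘ sym) ⟩
  (((C [ x ]≔ outside) [ u ]≔ outside) [ x ]≔ inside) [ v ]≔ inside
    ≡⟨ cong (_[ v ]≔ inside) ([]≔-commutes (C [ x ]≔ outside) u x u≢x) ⟩
  (((C [ x ]≔ outside) [ x ]≔ inside) [ u ]≔ outside) [ v ]≔ inside
    ≡⟨ cong (λ C′ → (C′ [ u ]≔ outside) [ v ]≔ inside) ([]≔-idempotent C x) ⟩
  ((C [ x ]≔ inside) [ u ]≔ outside) [ v ]≔ inside
    ≡⟨ cong (λ C′ → (C′ [ u ]≔ outside) [ v ]≔ inside) (x∈p⇒p[x]≔inside≡p x∈C) ⟩
  (C [ u ]≔ outside) [ v ]≔ inside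
    ∎

module _ {S D : Subset n} {u v : Fin n} (u∈S : u ∈ S) (u∉D : u ∉ D) (v∈D : v ∈ D) (v∉S : v ∉ S) where

  ∣S─D∣≡1+∣relocate─D∣ : ∣ S ─ D ∣ ≡ suc ∣ relocate S u v ─ D ∣
  ∣S─D∣≡1+∣relocate─D∣ = begin
    ∣ S ─ D ∣
      ≡⟨ x∈p⇒∣p∣≡1+∣p[x]≔outside∣ (x∈p∧x∉q⇒x∈p─q u∈S u∉D) ⟩
    suc ∣ (S ─ D) [ u ]≔ outside ∣
      ≡⟨ cong (suc ∘ ∣_∣) (x∉q⇒p[x]≔b─q≡[p─q][x]≔b u∉D S outside) ⟨
    suc ∣ (S [ u ]≔ outside) ─ D ∣
      ≡⟨ cong (suc ∘ ∣_∣) (x∈q⇒p[x]≔b─q≡p─q v∈D (S [ u ]≔ outside) inside) ⟨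
    suc ∣ relocate S u v ─ D ∣
      ∎

  ∣D─S∣≡1+∣D─relocate∣ : ∣ D ─ S ∣ ≡ suc ∣ D ─ relocate S u v ∣
  ∣D─S∣≡1+∣D─relocate∣ = begin
    ∣ D ─ S ∣
      ≡⟨ x∈p⇒∣p∣≡1+∣p[x]≔outside∣ (x∈p∧x∉q⇒x∈p─q v∈D v∉S) ⟩
    suc ∣ (D ─ S) [ v ]≔ outside ∣
      ≡⟨ cong (λ C → suc ∣ C [ v ]≔ outside ∣) (x∉q⇒q─p[x]≔outside≡q─p u∉D S) ⟨
    suc ∣ (D ─ (S [ u ]≔ outside)) [ v ]≔ outside ∣
      ≡⟨ cong (suc ∘ ∣_∣) (q─p[x]≔inside≡[q─p][x]≔outside D (S [ u ]≔ outside) v) ⟨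
    suc ∣ D ─ relocate S u v ∣
      ∎

Unique⇒lookup-injective : ∀ {xs : List (Fin n)} → Unique xs → ∀ {i j} → List.lookup xs i ≡ List.lookup xs j → i ≡ j
Unique⇒lookup-injective (_ ∷ _) {Fin.zero} {Fin.zero} _ = refl
Unique⇒lookup-injective (x≢xs ∷ _) {Fin.zero} {Fin.suc j} e = contradiction e (All.lookup x≢xs (∈-lookup j))
Unique⇒lookup-injective (x≢xs ∷ _) {Fin.suc i} {Fin.zero} e = contradiction (sym e) (All.lookup x≢xs (∈-lookup i))
Unique⇒lookup-injective (_ ∷ uniq) {Fin.suc i} {Fin.suc j} e = cong Fin.suc (Unique⇒lookup-injective uniq e)

Unique⇒length≤ : ∀ {xs : List (Fin n)} → Unique xs → length xs ≤ n
Unique⇒length≤ uniq = injective⇒≤ (Unique⇒lookup-injective uniq)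

module _ {G : Graph n} where

  steps : ∀ {u v} → Walk G u v → ℕ
  steps here = 0
  steps (step _ w) = suc (steps w)

  vertices : ∀ {u v} → Walk G u v → List (Fin n)
  vertices {u} here = u List.∷ List.[]
  vertices {u} (step _ w) = u List.∷ vertices w

  length-vertices : ∀ {u v} (w : Walk G u v) → length (vertices w) ≡ suc (steps w)
  length-vertices here = refl
  length-vertices (step _ w) = cong suc (length-vertices w)

  suffix : ∀ {u v} (w : Walk G u v) → x ∈ₗ vertices w → Unique (vertices w) →
    ∃ λ (w′ : Walk G x v) → Unique (vertices w′)
  suffix here (Any.here refl) uniq = here , uniq
  suffix w@(step _ _) (Any.here refl) uniq = w , uniq
  suffix (step _ w) (Any.there x∈w) (_ ∷ uniq) = suffix w x∈w uniq

  simplify : ∀ {u v} → Walk G u v → ∃ λ (w : Walk G u v) → Unique (vertices w)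
  simplify here = here , All.[] ∷ []
  simplify {u} (step u~x w) with simplify w
  ... | w′ , uniq with DecMembership._∈?_ _≟_ u (vertices w′)
  ...   | yes u∈w′ = suffix w′ u∈w′ uniq
  ...   | no u∉w′ = step u~x w′ , ¬Any⇒All¬ (vertices w′) u∉w′ ∷ uniq

  shortWalk : ∀ {u v} → Walk G u v → ∃ λ (w : Walk G u v) → steps w ≤ n ∸ 1
  shortWalk w =
    let w′ , uniq = simplify w
    in w′ , ∸-monoˡ-≤ 1 (subst (_≤ n) (length-vertices w′) (Unique⇒length≤ uniq))

  _++ᴾ_ : ∀ {C D E a b} → Plan G C D a → Plan G D E b → Plan G C E (a + b)
  done ++ᴾ q = q
  move m p ++ᴾ q = move m (p ++ᴾ q)

  _▷_ : ∀ {C D E m} → Plan G C D m → Move G D E → Plan G C E (suc m)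
  done ▷ m′ = move m′ done
  move m p ▷ m′ = move m (p ▷ m′)

  module _ (loopless : Loopless G) where

    -- If the next node x is occupied, its pebble is sent on to v first and the pebble on u
    -- then steps into the vacated x; either way every edge of the walk costs one move.
    cascade : ∀ {C u v} (w : Walk G u v) → u ∈ C → v ∉ C →
      ∃ λ m → m ≤ steps w × Plan G C (relocate C u v) m
    cascade here u∈C u∉C = contradiction u∈C u∉C
    cascade {C} {u} {v} (step {w = x} u~x w) u∈C v∉C with x ≟ v
    ... | yes refl = 1 , s≤s z≤n , move (u , x , u~x , u∈C , v∉C , refl) done
    ... | no x≢v with x ∈? C
    ...   | no x∉C =
      let m , m≤ , plan = cascade w v∈relocate (v∉C ∘ ∈-relocate⁻ v≢u (x≢v ∘ sym))
      in suc m , s≤s m≤ ,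
         move (u , x , u~x , u∈C , x∉C , refl) (subst (λ E → Plan G _ E m) (relocate-via-vacant v x∉C u≢x) plan)
      where
      u≢x : u ≢ x
      u≢x refl = x∉C u∈C
      v≢u : v ≢ u
      v≢u refl = v∉C u∈C
    ...   | yes x∈C =
      let m , m≤ , plan = cascade w x∈C v∉C
      in suc m , s≤s m≤ ,
         subst (λ E → Plan G C E (suc m)) (relocate-via-occupied x∈C u≢x u≢v x≢v)
           (plan ▷ (u , x , u~x , ∈-relocate⁺ u≢x u≢v u∈C , u∉relocate x≢v , refl))
      where
      u≢x : u ≢ x
      u≢x refl = loopless u u~x
      u≢v : u ≢ v
      u≢v refl = v∉C u∈C

    reconfigure : Connected G → ∀ r (S D : Subset n) → ∣ S ─ D ∣ ≡ r → ∣ D ─ S ∣ ≡ r →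
      ∃ λ m → m ≤ r * (n ∸ 1) × Plan G S D m
    reconfigure _ zero S D ∣S─D∣≡0 ∣D─S∣≡0 =
      0 , z≤n , subst (λ E → Plan G S E 0) (⊆-antisym (∣p─q∣≡0⇒p⊆q ∣S─D∣≡0) (∣p─q∣≡0⇒p⊆q ∣D─S∣≡0)) done
    reconfigure connected (suc r) S D ∣S─D∣≡1+r ∣D─S∣≡1+r =
      let u , u∈S─D = ∣p∣≡1+r⇒Nonempty ∣S─D∣≡1+r
          v , v∈D─S = ∣p∣≡1+r⇒Nonempty ∣D─S∣≡1+r
          u∈S = p─q⊆p S D u∈S─D ; u∉D = x∈p─q⇒x∉q u∈S─D
          v∈D = p─q⊆p D S v∈D─S ; v∉S = x∈p─q⇒x∉q v∈D─S
          w , w≤ = shortWalk (connected u v)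
          m₁ , m₁≤ , plan₁ = cascade w u∈S v∉S
          m₂ , m₂≤ , plan₂ = reconfigure connected r (relocate S u v) D
            (suc-injective (trans (sym (∣S─D∣≡1+∣relocate─D∣ u∈S u∉D v∈D v∉S)) ∣S─D∣≡1+r))
            (suc-injective (trans (sym (∣D─S∣≡1+∣D─relocate∣ u∈S u∉D v∈D v∉S)) ∣D─S∣≡1+r))
      in m₁ + m₂ , +-mono-≤ (≤-trans m₁≤ w≤) m₂≤ , plan₁ ++ᴾ plan₂

mainTheorem4 : (n k : ℕ) (T : Graph n) → IsTree T →
    (S D : Subset n) → ∣ S ∣ ≡ k → ∣ D ∣ ≡ k →
    ∃ λ m → m ≤ k * (n ∸ 1) × Plan T S D m
mainTheorem4 n k T (_ , loopless , connected , _) S D ∣S∣≡k ∣D∣≡k =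
  let m , m≤ , plan = reconfigure loopless connected ∣ S ─ D ∣ S D refl
                        (sym (∣p∣≡∣q∣⇒∣p─q∣≡∣q─p∣ S D (trans ∣S∣≡k (sym ∣D∣≡k))))
      ∣S─D∣≤k = subst (∣ S ─ D ∣ ≤_) ∣S∣≡k (∣p─q∣≤∣p∣ S D)
  in m , ≤-trans m≤ (*-monoˡ-≤ (n ∸ 1) ∣S─D∣≤k) , plan
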